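{- Let $(\k,G,\alpha)$ be a concise augmented kei and let $f\colon\k\to\k'$ be a surjective kei morphism. Then there is a unique group homomorphism $\rho\colon G\to\textnormal{Inn}(\k')$ such that $(f,\rho)\colon(\k,G,\alpha)\to(\k',\textnormal{Inn}(\k'),\varphi_{\k'})$ is a morphism of augmented keis. Furthermore, $\rho$ is surjective.
   Context: A kei is a set $\k$ with a binary operation $\triangleright$ such that $x\triangleright x=x$, $x\triangleright(x\triangleright y)=y$, $x\triangleright(y\triangleright z)=(x\triangleright y)\triangleright(x\triangleright z)$; kei morphisms preserve $\triangleright$. For $x\in\k$, $\varphi_{\k,x}\colon y\mapsto x\triangleright y$ is a kei automorphism; $\textnormal{Inn}(\k)$ is the subgroup of automorphisms generated by all $\varphi_{\k,x}$, and $\varphi_\k\colon\k\to\textnormal{Inn}(\k)$, $x\mapsto\varphi_{\k,x}$. An augmented kei $(\k,G,\alpha)$ is a set $\k$ with a left action of a group $G$ and a map $\alpha\colon\k\to G$, $x\mapsto\alpha_x$, such that $\alpha_x(x)=x$, $\alpha_x^2=1$, and $\alpha_{g(x)}=g\alpha_xg^{ -1}$ for all $x\in\k$, $g\in G$; $\k$ is then a kei via $x\triangleright y=\alpha_x(y)$, and $(\k',\textnormal{Inn}(\k'),\varphi_{\k'})$ is an augmented kei. A morphism $(\k,G,\alpha)\to(\k',G',\alpha')$ is a pair of a map $f\colon\k\to\k'$ and a homomorphism $\widetilde f\colon G\to G'$ with $\alpha'_{f(x)}=\widetilde f(\alpha_x)$ and $f(g(x))=\widetilde f(g)(f(x))$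 for all $x,g$. An augmented kei is concise if $\{\alpha_x:x\in\k\}$ generates $G$. In the claim, $\k$ carries the kei structure $x\triangleright y=\alpha_x(y)$. -}

module Defs where

open import Level using (Level; _⊔_; 0ℓ)
open import Function using (_∘_; id)
open import Data.Product using (Σ; ∃; _×_; _,_; proj₁; proj₂)
open import Relation.Binary.PropositionalEquality
  using (_≡_; refl; sym; trans; cong; cong₂)
open import Algebra.Bundles using (Group)
open import Algebra.Structures using (IsGroup)
open import Algebra.Morphism.Structures using (module GroupMorphisms)

record Kei : Set₁ where
  infixr 6 _▷_
  field
    Carrier  : Set
    _▷_      : Carrier → Carrier → Carrier
    idem     : ∀ x → x ▷ x ≡ x
    invol    : ∀ x y → x ▷ (x ▷ y) ≡ y
    selfdist : ∀ x y z → x ▷ (y ▷ z) ≡ (x ▷ y) ▷ (x ▷ z)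

IsKeiMorphism : (k k' : Kei) → (Kei.Carrier k → Kei.Carrier k') → Set
IsKeiMorphism k k' f =
  ∀ x y → f (Kei._▷_ k x y) ≡ Kei._▷_ k' (f x) (f y)

Surjective : {A B : Set} → (A → B) → Set
Surjective {A} {B} f = ∀ (b : B) → ∃ λ (a : A) → f a ≡ b

module _ {c ℓ s : Level} (G : Group c ℓ) where
  open Group G

  data Gen (S : Carrier → Set s) : Carrier → Set (c ⊔ ℓ ⊔ s) where
    gen  : ∀ {g} → S g → Gen S g
    one  : Gen S ε
    mul  : ∀ {g h} → Gen S g → Gen S h → Gen S (g ∙ h)
    inv  : ∀ {g} → Gen S g → Gen S (g ⁻¹)
    resp : ∀ {g h} → g ≈ h → Gen S g → Gen S h

  Generates : (S : Carrier → Set s) → Set (c ⊔ ℓ ⊔ s)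
  Generates S = ∀ g → Gen S g

  ⟨_⟩ : (S : Carrier → Set s) → Group (c ⊔ ℓ ⊔ s) ℓ
  ⟨ S ⟩ = record
    { Carrier = Σ Carrier (Gen S)
    ; _≈_ = λ a b → proj₁ a ≈ proj₁ b
    ; _∙_ = λ a b → (proj₁ a ∙ proj₁ b) , mul (proj₂ a) (proj₂ b)
    ; ε = ε , one
    ; _⁻¹ = λ a → (proj₁ a ⁻¹) , inv (proj₂ a)
    ; isGroup = record
      { isMonoid = record
        { isSemigroup = record
          { isMagma = record
            { isEquivalence = record
              { refl = Group.refl G ; sym = Group.sym G ; trans = Group.trans G }
            ; ∙-cong = ∙-cong }
          ; assoc = λ a b c → assoc (proj₁ a) (proj₁ b) (proj₁ c) }
        ; identity = (λ a → identityˡ (proj₁ a)) , (λ a → identityʳ (proj₁ a)) }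
      ; inverse = (λ a → inverseˡ (proj₁ a)) , (λ a → inverseʳ (proj₁ a))
      ; ⁻¹-cong = ⁻¹-cong }
    }

module _ (k : Kei) where
  open Kei k

  record Automorphism : Set where
    field
      to       : Carrier → Carrier
      from     : Carrier → Carrier
      from-to  : ∀ x → from (to x) ≡ x
      to-from  : ∀ x → to (from x) ≡ x
      to-hom   : ∀ x y → to (x ▷ y) ≡ to x ▷ to y
  open Automorphism

  private
    compA : Automorphism → Automorphism → Automorphism
    compA σ τ = record
      { to = to σ ∘ to τ
      ; from = from τ ∘ from σ
      ; from-to = λ x → trans (cong (from τ) (from-to σ (to τ x))) (from-to τ x)
      ; to-from = λ x → trans (cong (to σ) (to-from τ (from σ x))) (to-from σ x)
      ; to-hom = λ x y → trans (cong (to σ) (to-hom τ x y)) (to-hom σ (to τ x) (to τ y))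
      }
    invA : Automorphism → Automorphism
    invA σ = record
      { to = from σ ; from = to σ ; from-to = to-from σ ; to-from = from-to σ
      ; to-hom = λ x y → trans
          (cong (from σ) (cong₂ _▷_ (sym (to-from σ x)) (sym (to-from σ y))))
          (trans (cong (from σ) (sym (to-hom σ (from σ x) (from σ y))))
                 (from-to σ (from σ x ▷ from σ y)))
      }
    idA : Automorphism
    idA = record { to = id ; from = id ; from-to = λ _ → refl
                 ; to-from = λ _ → refl ; to-hom = λ _ _ → refl }

  _≈A_ : Automorphism → Automorphism → Set
  σ ≈A τ = ∀ x → to σ x ≡ to τ x

  Aut : Group 0ℓ 0ℓ
  Aut = record
    { Carrier = Automorphism
    ; _≈_ = _≈A_
    ; _∙_ = compA
    ; ε = idA
    ; _⁻¹ = invA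
    ; isGroup = record
      { isMonoid = record
        { isSemigroup = record
          { isMagma = record
            { isEquivalence = record
              { refl = λ _ → refl
              ; sym = λ p x → sym (p x)
              ; trans = λ p q x → trans (p x) (q x) }
            ; ∙-cong = λ {σ} {σ'} {τ} {τ'} p q x → trans (cong (to σ) (q x)) (p (to τ' x)) }
          ; assoc = λ _ _ _ _ → refl }
        ; identity = (λ _ _ → refl) , (λ _ _ → refl) }
      ; inverse = (λ σ x → from-to σ x) , (λ σ x → to-from σ x)
      ; ⁻¹-cong = λ {σ} {σ'} p x →
          trans (cong (from σ) (sym (to-from σ' x)))
                (trans (cong (from σ) (sym (p (from σ' x)))) (from-to σ (from σ' x)))
      }
    }

  φ : Carrier → Automorphism
  φ x = record
    { to = x ▷_ ; from = x ▷_ ; from-to = invol x ; to-from = invol x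
    ; to-hom = selfdist x }

  IsInnerGenerator : Automorphism → Set
  IsInnerGenerator σ = ∃ λ x → σ ≈A φ x

  Inn : Group 0ℓ 0ℓ
  Inn = ⟨_⟩ Aut IsInnerGenerator

  φInn : Carrier → Group.Carrier Inn
  φInn x = φ x , gen (x , λ _ → refl)

  applyInn : Group.Carrier Inn → Carrier → Carrier
  applyInn ρ = to (proj₁ ρ)

record AugmentedKei {c ℓ : Level} (G : Group c ℓ) : Set (Level.suc 0ℓ ⊔ c ⊔ ℓ) where
  open Group G using (_≈_; _∙_; ε; _⁻¹; inverseˡ)
  field
    Carrier   : Set
    act       : Group.Carrier G → Carrier → Carrier
    act-cong  : ∀ {g h} → g ≈ h → ∀ x → act g x ≡ act h x
    act-ε     : ∀ x → act ε x ≡ x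
    act-∙     : ∀ g h x → act (g ∙ h) x ≡ act g (act h x)
    α         : Carrier → Group.Carrier G
    α-fix     : ∀ x → act (α x) x ≡ x
    α-sq      : ∀ x → α x ∙ α x ≈ ε
    α-equiv   : ∀ g x → α (act g x) ≈ (g ∙ α x) ∙ g ⁻¹

  _▷_ : Carrier → Carrier → Carrier
  x ▷ y = act (α x) y

  private
    invol′ : ∀ x y → x ▷ (x ▷ y) ≡ y
    invol′ x y = trans (sym (act-∙ (α x) (α x) y))
                       (trans (act-cong (α-sq x) y) (act-ε y))
    selfdist′ : ∀ x y z → x ▷ (y ▷ z) ≡ (x ▷ y) ▷ (x ▷ z)
    selfdist′ x y z = sym (trans
      (act-cong (α-equiv (α x) y) (act (α x) z))
      (trans (act-∙ (α x ∙ α y) (α x ⁻¹) (act (α x) z))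
      (trans (cong (act (α x ∙ α y)) (trans (sym (act-∙ (α x ⁻¹) (α x) z))
                 (trans (act-cong (inverseˡ (α x)) z) (act-ε z))))
             (act-∙ (α x) (α y) z))))

  kei : Kei
  kei = record { Carrier = Carrier ; _▷_ = _▷_ ; idem = α-fix
               ; invol = invol′ ; selfdist = selfdist′ }

IsConcise : ∀ {c ℓ} {G : Group c ℓ} → AugmentedKei G → Set (c ⊔ ℓ)
IsConcise {G = G} A =
  Generates {s = 0ℓ ⊔ _} G (λ g → ∃ λ x → g ≈ AugmentedKei.α A x)
  where open Group G using (_≈_)

-- (f , ρ) : (k, G, α) → (k', Inn(k'), φ_{k'}) is a morphism of augmented
-- keis (ρ being a group homomorphism is stated separately)
IsAugMorphismToInn : ∀ {c ℓ} {G : Group c ℓ} (A : AugmentedKei G) (k' : Kei)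
  → (AugmentedKei.Carrier A → Kei.Carrier k')
  → (Group.Carrier G → Group.Carrier (Inn k')) → Set c
IsAugMorphismToInn {G = G} A k' f ρ =
    (∀ x → Group._≈_ (Inn k') (φInn k' (f x)) (ρ (AugmentedKei.α A x)))
  × (∀ g x → f (AugmentedKei.act A g x) ≡ applyInn k' (ρ g) (f x))

IsGroupHom : ∀ {a ℓ₁ b ℓ₂} (G : Group a ℓ₁) (H : Group b ℓ₂)
  → (Group.Carrier G → Group.Carrier H) → Set (a ⊔ ℓ₁ ⊔ ℓ₂)
IsGroupHom G H = GroupMorphisms.IsGroupHomomorphism (Group.rawGroup G) (Group.rawGroup H)

SurjectiveHom : ∀ {a ℓ₁ b ℓ₂} (G : Group a ℓ₁) (H : Group b ℓ₂)
  → (Group.Carrier G → Group.Carrier H) → Set (a ⊔ b ⊔ ℓ₂)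
SurjectiveHom G H ρ = ∀ h → ∃ λ g → Group._≈_ H (ρ g) h

-- Concision is what makes the G-action descend along f: every g ∈ G is built from the
-- involutions α_x, each of which maps fibres of f to fibres because f is a kei morphism,
-- so g does too, and surjectivity of f turns g into a well-defined automorphism ρ(g) of k'
-- with ρ(α_x) = φ_{f(x)}.  Hence ρ lands in Inn(k'), it is the only possible choice
-- (f ∘ g = ρ(g) ∘ f pins ρ(g) down on the image of f, which is everything), and its image
-- contains every generator φ_{f(x)} of Inn(k'), so ρ is surjective.
module Submission where

open import Defs
open import Level using (Level)
open import Data.Product using (Σ; ∃; _×_; _,_; proj₁; proj₂)
open import Algebra.Bundles using (Group)
open import Relation.Binary.PropositionalEquality
  using (_≡_; refl; sym; trans; cong; cong₂; module ≡-Reasoning)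
import Algebra.Properties.Group as GroupProperties
open import Algebra.Morphism.Structures using (module GroupMorphisms)

module _ {c ℓ s p : Level} (G : Group c ℓ) {S : Group.Carrier G → Set s} where
  open Group G

  Gen-ind : (P : Carrier → Set p)
    → (∀ {g h} → g ≈ h → P g → P h)
    → (∀ {g} → S g → P g)
    → P ε
    → (∀ {g h} → P g → P h → P (g ∙ h))
    → (∀ {g} → P g → P (g ⁻¹))
    → ∀ {g} → Gen G S g → P g
  Gen-ind P P-resp P-gen P-ε P-∙ P-⁻¹ = go
    where
    go : ∀ {g} → Gen G S g → P g
    go (gen s)    = P-gen s
    go one        = P-ε
    go (mul d d′) = P-∙ (go d) (go d′)
    go (inv d)    = P-⁻¹ (go d)
    go (resp e d) = P-resp e (go d)

module _ {a b ℓ₁ ℓ₂ : Level} (G : Group a ℓ₁) (H : Group b ℓ₂)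
         {h : Group.Carrier G → Group.Carrier H} (h-hom : IsGroupHom G H h) where
  private
    module G = Group G
    module H = Group H
  open GroupMorphisms.IsGroupHomomorphism h-hom

  Gen-map : {s t : Level} {S : G.Carrier → Set s} {T : H.Carrier → Set t}
    → (∀ {g} → S g → T (h g)) → ∀ {g} → Gen G S g → Gen H T (h g)
  Gen-map S⇒T = Gen-ind G (λ g → Gen H _ (h g))
    (λ e → resp (⟦⟧-cong e))
    (λ s → gen (S⇒T s))
    (resp (H.sym ε-homo) one)
    (λ {g} {g′} d d′ → resp (H.sym (homo g g′)) (mul d d′))
    (λ {g} d → resp (H.sym (⁻¹-homo g)) (inv d))

  Gen-⊆-image : {t : Level} {T : H.Carrier → Set t}
    → (∀ {y} → T y → ∃ λ g → h g H.≈ y) → ∀ {y} → Gen H T y → ∃ λ g → h g H.≈ y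
  Gen-⊆-image T⊆image = Gen-ind H (λ y → ∃ λ g → h g H.≈ y)
    (λ e (g , hg≈y) → g , H.trans hg≈y e)
    T⊆image
    (G.ε , ε-homo)
    (λ (g , hg≈y) (g′ , hg′≈y′) → g G.∙ g′ , H.trans (homo g g′) (H.∙-cong hg≈y hg′≈y′))
    (λ (g , hg≈y) → g G.⁻¹ , H.trans (⁻¹-homo g) (H.⁻¹-cong hg≈y))

  corestrict-isGroupHom : {t : Level} {T : H.Carrier → Set t} (h∈⟨T⟩ : ∀ g → Gen H T (h g))
    → IsGroupHom G (⟨_⟩ H T) (λ g → h g , h∈⟨T⟩ g)
  corestrict-isGroupHom _ = record
    { isMonoidHomomorphism = record
      { isMagmaHomomorphism = record
        { isRelHomomorphism = record { cong = ⟦⟧-cong }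
        ; homo = homo }
      ; ε-homo = ε-homo }
    ; ⁻¹-homo = ⁻¹-homo }

module _ {c ℓ : Level} {G : Group c ℓ} (A : AugmentedKei G) where
  open Group G using (_≈_; _∙_; ε; _⁻¹; inverseˡ) renaming (sym to ≈-sym)
  open GroupProperties G using (inverseʳ-unique)
  open AugmentedKei A
  open ≡-Reasoning

  act-inverseˡ : ∀ g x → act (g ⁻¹) (act g x) ≡ x
  act-inverseˡ g x = begin
    act (g ⁻¹) (act g x) ≡⟨ act-∙ (g ⁻¹) g x ⟨
    act (g ⁻¹ ∙ g) x     ≡⟨ act-cong (inverseˡ g) x ⟩
    act ε x              ≡⟨ act-ε x ⟩
    x                    ∎

  act-▷ : ∀ g x y → act g (x ▷ y) ≡ act g x ▷ act g y
  act-▷ g x y = sym (begin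
    act (α (act g x)) (act g y)          ≡⟨ act-cong (α-equiv g x) (act g y) ⟩
    act ((g ∙ α x) ∙ g ⁻¹) (act g y)     ≡⟨ act-∙ (g ∙ α x) (g ⁻¹) (act g y) ⟩
    act (g ∙ α x) (act (g ⁻¹) (act g y)) ≡⟨ cong (act (g ∙ α x)) (act-inverseˡ g y) ⟩
    act (g ∙ α x) y                      ≡⟨ act-∙ g (α x) y ⟩
    act g (act (α x) y)                  ∎)

  α-selfInverse : ∀ x → α x ⁻¹ ≈ α x
  α-selfInverse x = ≈-sym (inverseʳ-unique (α x) (α x) (α-sq x))

module Descent {c ℓ : Level} {G : Group c ℓ} (A : AugmentedKei G) (k′ : Kei)
    (concise : IsConcise A)
    (f : AugmentedKei.Carrier A → Kei.Carrier k′)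
    (f-hom : IsKeiMorphism (AugmentedKei.kei A) k′ f)
    (f-surj : Surjective f) where
  open Group G using (Carrier; _≈_; _∙_; ε; _⁻¹; ⁻¹-cong; inverseˡ; inverseʳ)
    renaming (sym to ≈-sym; trans to ≈-trans)
  open GroupProperties G using (ε⁻¹≈ε; ⁻¹-anti-homo-∙; ⁻¹-involutive)
  open AugmentedKei A renaming (Carrier to K; _▷_ to _▷₁_)
  open Kei k′ using (_▷_) renaming (Carrier to K′)
  open ≡-Reasoning

  PreservesKernel : Carrier → Set
  PreservesKernel g = ∀ {x x′} → f x ≡ f x′ → f (act g x) ≡ f (act g x′)

  preservesKernel-resp : ∀ {g h} → g ≈ h → PreservesKernel g → PreservesKernel h
  preservesKernel-resp {g} {h} g≈h pres {x} {x′} fx≡fx′ = begin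
    f (act h x)  ≡⟨ cong f (act-cong g≈h x) ⟨
    f (act g x)  ≡⟨ pres fx≡fx′ ⟩
    f (act g x′) ≡⟨ cong f (act-cong g≈h x′) ⟩
    f (act h x′) ∎

  preservesKernel-α : ∀ z → PreservesKernel (α z)
  preservesKernel-α z {x} {x′} fx≡fx′ = begin
    f (z ▷₁ x)  ≡⟨ f-hom z x ⟩
    f z ▷ f x   ≡⟨ cong (f z ▷_) fx≡fx′ ⟩
    f z ▷ f x′  ≡⟨ f-hom z x′ ⟨
    f (z ▷₁ x′) ∎

  preservesKernel-ε : PreservesKernel ε
  preservesKernel-ε {x} {x′} fx≡fx′ =
    trans (cong f (act-ε x)) (trans fx≡fx′ (sym (cong f (act-ε x′))))

  preservesKernel-∙ : ∀ {g h} → PreservesKernel g → PreservesKernel h → PreservesKernel (g ∙ h)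
  preservesKernel-∙ {g} {h} pres-g pres-h {x} {x′} fx≡fx′ =
    trans (cong f (act-∙ g h x)) (trans (pres-g (pres-h fx≡fx′)) (sym (cong f (act-∙ g h x′))))

  -- The invariant carries g ⁻¹ along with g, since preserving the kernel of f is not in general closed under inverses.
  preservesKernel : ∀ g → PreservesKernel g
  preservesKernel g = proj₁ (Gen-ind G (λ g → PreservesKernel g × PreservesKernel (g ⁻¹))
    (λ g≈h (pres , pres⁻¹) → preservesKernel-resp g≈h pres , preservesKernel-resp (⁻¹-cong g≈h) pres⁻¹)
    (λ (z , g≈αz) → preservesKernel-resp (≈-sym g≈αz) (preservesKernel-α z)
                  , preservesKernel-resp (≈-trans (≈-sym (α-selfInverse A z)) (⁻¹-cong (≈-sym g≈αz)))
                                         (preservesKernel-α z))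
    (preservesKernel-ε , preservesKernel-resp (≈-sym ε⁻¹≈ε) preservesKernel-ε)
    (λ {g} {h} (pres-g , pres-g⁻¹) (pres-h , pres-h⁻¹) →
        preservesKernel-∙ pres-g pres-h
      , preservesKernel-resp (≈-sym (⁻¹-anti-homo-∙ g h)) (preservesKernel-∙ pres-h⁻¹ pres-g⁻¹))
    (λ {g} (pres , pres⁻¹) → pres⁻¹ , preservesKernel-resp (≈-sym (⁻¹-involutive g)) pres)
    (concise g))

  section : K′ → K
  section y = proj₁ (f-surj y)

  f∘section : ∀ y → f (section y) ≡ y
  f∘section y = proj₂ (f-surj y)

  act′ : Carrier → K′ → K′
  act′ g y = f (act g (section y))

  act′-f : ∀ g x → act′ g (f x) ≡ f (act g x)
  act′-f g x = preservesKernel g (f∘section (f x))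

  act′-cong : ∀ {g h} → g ≈ h → ∀ y → act′ g y ≡ act′ h y
  act′-cong g≈h y = cong f (act-cong g≈h (section y))

  act′-ε : ∀ y → act′ ε y ≡ y
  act′-ε y = trans (cong f (act-ε (section y))) (f∘section y)

  act′-∙ : ∀ g h y → act′ (g ∙ h) y ≡ act′ g (act′ h y)
  act′-∙ g h y = trans (cong f (act-∙ g h (section y))) (sym (act′-f g (act h (section y))))

  act′-inverseˡ : ∀ g y → act′ (g ⁻¹) (act′ g y) ≡ y
  act′-inverseˡ g y =
    trans (sym (act′-∙ (g ⁻¹) g y)) (trans (act′-cong (inverseˡ g) y) (act′-ε y))

  act′-inverseʳ : ∀ g y → act′ g (act′ (g ⁻¹) y) ≡ y
  act′-inverseʳ g y =
    trans (sym (act′-∙ g (g ⁻¹) y)) (trans (act′-cong (inverseʳ g) y) (act′-ε y))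

  act′-α : ∀ x y → act′ (α x) y ≡ f x ▷ y
  act′-α x y = trans (f-hom x (section y)) (cong (f x ▷_) (f∘section y))

  act′-▷ : ∀ g y z → act′ g (y ▷ z) ≡ act′ g y ▷ act′ g z
  act′-▷ g y z = begin
    act′ g (y ▷ z)                                ≡⟨ cong (act′ g) (cong₂ _▷_ (f∘section y) (f∘section z)) ⟨
    act′ g (f (section y) ▷ f (section z))        ≡⟨ cong (act′ g) (f-hom (section y) (section z)) ⟨
    act′ g (f (section y ▷₁ section z))           ≡⟨ act′-f g (section y ▷₁ section z) ⟩
    f (act g (section y ▷₁ section z))            ≡⟨ cong f (act-▷ A g (section y) (section z)) ⟩
    f (act g (section y) ▷₁ act g (section z))    ≡⟨ f-hom (act g (section y)) (act g (section z)) ⟩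
    act′ g y ▷ act′ g z                           ∎

  aut : Carrier → Automorphism k′
  aut g = record
    { to = act′ g ; from = act′ (g ⁻¹)
    ; from-to = act′-inverseˡ g ; to-from = act′-inverseʳ g
    ; to-hom = act′-▷ g }

  aut-isGroupHom : IsGroupHom G (Aut k′) aut
  aut-isGroupHom = record
    { isMonoidHomomorphism = record
      { isMagmaHomomorphism = record
        { isRelHomomorphism = record { cong = act′-cong }
        ; homo = act′-∙ }
      ; ε-homo = act′-ε }
    ; ⁻¹-homo = λ _ _ → refl }

  aut∈Inn : ∀ g → Gen (Aut k′) (IsInnerGenerator k′) (aut g)
  aut∈Inn g = Gen-map G (Aut k′) aut-isGroupHom
    (λ (x , g≈αx) → f x , λ y → trans (act′-cong g≈αx y) (act′-α x y))
    (concise g)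

  ρ : Carrier → Group.Carrier (Inn k′)
  ρ g = aut g , aut∈Inn g

  ρ-isGroupHom : IsGroupHom G (Inn k′) ρ
  ρ-isGroupHom = corestrict-isGroupHom G (Aut k′) aut-isGroupHom aut∈Inn

  ρ-isAugMorphism : IsAugMorphismToInn A k′ f ρ
  ρ-isAugMorphism = (λ x y → sym (act′-α x y)) , (λ g x → sym (act′-f g x))

  ρ-unique : (ρ′ : Carrier → Group.Carrier (Inn k′)) → IsAugMorphismToInn A k′ f ρ′
    → ∀ g → Group._≈_ (Inn k′) (ρ′ g) (ρ g)
  ρ-unique ρ′ (_ , ρ′-act) g y =
    trans (cong (applyInn k′ (ρ′ g)) (sym (f∘section y))) (sym (ρ′-act g (section y)))

  ρ-surjective : SurjectiveHom G (Inn k′) ρ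
  ρ-surjective (_ , σ∈Inn) = Gen-⊆-image G (Aut k′) aut-isGroupHom
    (λ (y , σ≈φy) → α (section y) , λ z →
       trans (act′-α (section y) z) (trans (cong (_▷ z) (f∘section y)) (sym (σ≈φy z))))
    σ∈Inn

proposition2p11 : {c ℓ : Level} {G : Group c ℓ} (A : AugmentedKei G) (k' : Kei)
    → IsConcise A
    → (f : AugmentedKei.Carrier A → Kei.Carrier k')
    → IsKeiMorphism (AugmentedKei.kei A) k' f
    → Surjective f
    → Σ (Group.Carrier G → Group.Carrier (Inn k')) (λ ρ →
        (IsGroupHom G (Inn k') ρ × IsAugMorphismToInn A k' f ρ)
        × ((ρ' : Group.Carrier G → Group.Carrier (Inn k'))
             → IsGroupHom G (Inn k') ρ' → IsAugMorphismToInn A k' f ρ'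
             → (g : Group.Carrier G) → Group._≈_ (Inn k') (ρ' g) (ρ g))
        × SurjectiveHom G (Inn k') ρ)
proposition2p11 A k' concise f f-hom f-surj =
  ρ , (ρ-isGroupHom , ρ-isAugMorphism) , (λ ρ′ _ → ρ-unique ρ′) , ρ-surjective
  where open Descent A k' concise f f-hom f-surj
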